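{- Let $n \ge 3$ be odd. (i) For each vertex $v$ of $P_2 \square P_3$, $DV(v) = 1$. (ii) For $n \ge 5$ and $1 \le i \le n$, $DV(x_i) = DV(y_i) = 1$ if $i$ is odd and $DV(x_i)=DV(y_i) = 0$ if $i$ is even, where domination values are taken in $P_2 \square P_n$.
   Context: $P_2 \square P_n$ is viewed as two copies of the path $P_n$ with vertices $x_1,\dots,x_n$ and $y_1,\dots,y_n$ (edges $x_ix_{i+1}$, $y_iy_{i+1}$), together with the edges $x_iy_i$ for $1\le i\le n$. A minimum dominating set of a graph $G$ is a set $D\subseteq V(G)$ of minimum cardinality such that every vertex not in $D$ is adjacent to a vertex of $D$. For $v \in V(G)$, the domination value $DV_G(v)$ (written $DV(v)$) is the number of minimum dominating sets of $G$ that contain $v$. -}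

module Defs where

open import Data.Nat using (ℕ; suc; _+_; _≤_)
open import Data.Fin using (Fin; toℕ)
open import Data.Fin.Subset using (Subset; _∈_; ∣_∣)
open import Data.Product using (Σ; _×_; _,_; ∃)
open import Data.Sum using (_⊎_)
open import Data.List using (List; length)
import Data.List.Membership.Propositional as LMem
open import Data.List.Relation.Unary.Unique.Propositional using (Unique)
open import Relation.Binary.PropositionalEquality using (_≡_; _≢_)
open import Function.Bundles using (_⇔_)

-- Vertices of P₂ □ Pₙ : (row , i) with row 0 = x-path, row 1 = y-path,
-- i : Fin n stands for index i+1 (so x_{i+1} = (0 , i), y_{i+1} = (1 , i)).
Vertex : ℕ → Set
Vertex n = Fin 2 × Fin n

Adj : ∀ {n} → Vertex n → Vertex n → Set
Adj (a , i) (b , j) =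
  (a ≡ b × (toℕ j ≡ suc (toℕ i) ⊎ toℕ i ≡ suc (toℕ j)))
  ⊎ (a ≢ b × i ≡ j)

-- A vertex set: (x-row subset , y-row subset).
VSet₂ : ℕ → Set
VSet₂ n = Subset n × Subset n

row : ∀ {n} → VSet₂ n → Fin 2 → Subset n
row (X , Y) Fin.zero = X
row (X , Y) (Fin.suc Fin.zero) = Y
  where import Data.Fin as Fin

_∈V_ : ∀ {n} → Vertex n → VSet₂ n → Set
(a , i) ∈V D = i ∈ row D a

card : ∀ {n} → VSet₂ n → ℕ
card (X , Y) = ∣ X ∣ + ∣ Y ∣

Dominating : ∀ n → VSet₂ n → Set
Dominating n D = ∀ (v : Vertex n) → v ∈V D ⊎ ∃ λ u → u ∈V D × Adj u v

MinDominating : ∀ n → VSet₂ n → Set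
MinDominating n D = Dominating n D × (∀ D′ → Dominating n D′ → card D ≤ card D′)

-- DV n v k : the number of minimum dominating sets of P₂ □ Pₙ containing v
-- equals k, i.e. those sets are exactly the entries of a duplicate-free list
-- of length k.
DV : ∀ n → Vertex n → ℕ → Set
DV n v k = Σ (List (VSet₂ n)) λ L →
  Unique L × length L ≡ k × (∀ D → (D LMem.∈ L) ⇔ (MinDominating n D × v ∈V D))

module Submission where

-- A vertex set is read as a word of columns over Col = Bool × Bool (column
-- i records whether x_i and y_i are chosen).  First, a set is dominating
-- exactly when its word is Dominated: each column is covered by itself and
-- its two neighbouring columns.  Walking along a dominated word while
-- remembering the previous column then gives, by one mutual induction, the
-- bound 2 ∣D∣ ≥ n + 1, and a second induction of the same shape shows that
-- the words attaining it are the zigzags  x ∅ y ∅ x …  and  y ∅ x ∅ y …,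
-- plus ∅ {x,y} ∅ when n = 3.  Odd-length zigzags do attain it, so for
-- n = 2k + 1 the minimum dominating sets are exactly the entries of an
-- explicit duplicate-free list, and DV(v) counts the entries containing v.
-- For n ≥ 5 the two zigzags are mirror images, so DV(x_i) = DV(y_i) is the
-- number of chosen vertices in column i of one zigzag: 1 for odd i, 0 for
-- even i.  For n = 3 the six counts are evaluated directly.

open import Defs
open import Data.Nat using (ℕ; zero; suc; _+_; _*_; _≤_; z≤n; s≤s; _%_; _/_)
open import Data.Nat.Properties
  using (suc-injective; +-suc; +-identityʳ; +-comm; ≤-antisym; <⇒≢; m≤n⇒m≤1+n; m≤n⇒m≤o+n;
         *-cancelʳ-≤; *-monoˡ-≤; module ≤-Reasoning)
open import Data.Nat.DivMod using (m≡m%n+[m/n]*n)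
open import Data.Bool using (Bool; true; false; _∨_; T)
open import Data.Bool.Properties using (T-∨; T-≡)
open import Data.Fin using (Fin; toℕ; zero; suc)
open import Data.Fin.Subset using (Subset; _∈_; ∣_∣)
open import Data.Product using (Σ; ∃; _×_; _,_; proj₁; proj₂; swap)
open import Data.Sum using (_⊎_; inj₁; inj₂; map₂)
open import Data.Unit using (⊤; tt)
open import Data.Empty using (⊥-elim)
open import Data.Vec using (Vec; []; _∷_; lookup; map; zip; unzip)
open import Data.Vec.Properties using (lookup-unzip; unzip∘zip; lookup-map; []=⇒lookup; lookup⇒[]=)
open import Data.List using (List; []; _∷_; length; filter)
open import Data.List.Relation.Unary.Any using (here; there)
open import Data.List.Relation.Unary.All using ([]; _∷_)
open import Data.List.Relation.Unary.AllPairs using ([]; _∷_)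
open import Data.List.Relation.Unary.Unique.Propositional using (Unique)
open import Data.List.Relation.Unary.Unique.Propositional.Properties using (filter⁺)
open import Data.List.Membership.Propositional using () renaming (_∈_ to _∈ₗ_)
open import Data.List.Membership.Propositional.Properties using (∈-filter⁺; ∈-filter⁻)
open import Relation.Nullary using (Dec; does; ¬_)
open import Relation.Nullary.Decidable using (map′; T?)
open import Relation.Binary.PropositionalEquality
  using (_≡_; _≢_; refl; sym; trans; cong; cong₂; subst; module ≡-Reasoning)
open import Function.Bundles using (_⇔_; mk⇔; Equivalence)
open Equivalence using (to; from)

Col : Set
Col = Bool × Bool

pattern O = (false , false)
pattern X = (true , false)
pattern Y = (false , true)
pattern B = (true , true)

Word : ℕ → Set
Word = Vec Col

bit : Fin 2 → Col → Bool
bit zero = proj₁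
bit (suc zero) = proj₂

other : Fin 2 → Fin 2
other zero = suc zero
other (suc zero) = zero

other-≢ : ∀ a → other a ≢ a
other-≢ zero ()
other-≢ (suc zero) ()

≢⇒other : ∀ {a b : Fin 2} → b ≢ a → b ≡ other a
≢⇒other {zero} {zero} b≢a = ⊥-elim (b≢a refl)
≢⇒other {zero} {suc zero} _ = refl
≢⇒other {suc zero} {zero} _ = refl
≢⇒other {suc zero} {suc zero} b≢a = ⊥-elim (b≢a refl)

bit-O : ∀ a → ¬ T (bit a O)
bit-O zero ()
bit-O (suc zero) ()

indicator : Bool → ℕ
indicator true = 1
indicator false = 0

weight : Col → ℕ
weight (b₁ , b₂) = indicator b₁ + indicator b₂

-- Twice the number of chosen vertices of a word; doubling keeps the
-- bound 2 ∣D∣ ≥ m + 1 free of division.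
dsize : ∀ {m} → Word m → ℕ
dsize [] = 0
dsize (c ∷ r) = weight c + weight c + dsize r

-- The column at a natural-number position, empty beyond the end; this
-- is how the neighbours of the first and last column are read.
at : ∀ {m} → Word m → ℕ → Col
at [] _ = O
at (c ∷ r) zero = c
at (c ∷ r) (suc k) = at r k

at-lookup : ∀ {m} (cs : Word m) (i : Fin m) → at cs (toℕ i) ≡ lookup cs i
at-lookup (c ∷ r) zero = refl
at-lookup (c ∷ r) (suc i) = at-lookup r i

at-inRange : ∀ {m} (cs : Word m) a k → T (bit a (at cs k)) → Σ (Fin m) λ j → toℕ j ≡ k
at-inRange [] a k t = ⊥-elim (bit-O a t)
at-inRange (c ∷ r) a zero t = zero , refl
at-inRange (c ∷ r) a (suc k) t with at-inRange r a k t
... | j , refl = suc j , refl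

columns : ∀ {n} (D : VSet₂ n) → ∃ λ (cs : Word n) → unzip cs ≡ D
columns (Xs , Ys) = zip Xs Ys , unzip∘zip Xs Ys

lookup-row : ∀ {n} (cs : Word n) a i → lookup (row (unzip cs) a) i ≡ bit a (lookup cs i)
lookup-row cs zero i = cong proj₁ (lookup-unzip i cs)
lookup-row cs (suc zero) i = cong proj₂ (lookup-unzip i cs)

∈⇔T : ∀ {n} (i : Fin n) (p : Subset n) → i ∈ p ⇔ T (lookup p i)
∈⇔T i p = mk⇔ (λ i∈p → from T-≡ ([]=⇒lookup i∈p)) (λ t → lookup⇒[]= i p (to T-≡ t))

∈-unzip : ∀ {n} (cs : Word n) a i → (a , i) ∈V unzip cs ⇔ T (bit a (lookup cs i))
∈-unzip cs a i = mk⇔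
  (λ m → subst T (lookup-row cs a i) (to (∈⇔T i (row (unzip cs) a)) m))
  (λ t → from (∈⇔T i (row (unzip cs) a)) (subst T (sym (lookup-row cs a i)) t))

-- Membership is decided by reading the bit, so that counting members of a
-- list of sets computes.
_∈V?_ : ∀ {n} (v : Vertex n) (D : VSet₂ n) → Dec (v ∈V D)
(a , i) ∈V? D = map′ (from (∈⇔T i (row D a))) (to (∈⇔T i (row D a))) (T? (lookup (row D a) i))

does-∈V? : ∀ {n} (cs : Word n) a i → does ((a , i) ∈V? unzip cs) ≡ bit a (lookup cs i)
does-∈V? = lookup-row

Covered : Fin 2 → Col → Col → Col → Set
Covered a p c n = T (bit a p ∨ bit a c ∨ bit (other a) c ∨ bit a n)

ColumnCovered : Col → Col → Col → Set
ColumnCovered p c n = Covered zero p c n × Covered (suc zero) p c n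

column-row : ∀ {p c n} → ColumnCovered p c n → ∀ a → Covered a p c n
column-row (cov₀ , _) zero = cov₀
column-row (_ , cov₁) (suc zero) = cov₁

covered⇔ : ∀ a p c n →
  Covered a p c n ⇔ (T (bit a p) ⊎ T (bit a c) ⊎ T (bit (other a) c) ⊎ T (bit a n))
covered⇔ a p c n = mk⇔
  (λ cov → map₂ (λ cov′ → map₂ (to ∨₃) (to ∨₂ cov′)) (to ∨₁ cov))
  (λ cases → from ∨₁ (map₂ (λ case′ → from ∨₂ (map₂ (from ∨₃) case′)) cases))
  where
  ∨₁ = T-∨ {bit a p}
  ∨₂ = T-∨ {bit a c}
  ∨₃ = T-∨ {bit (other a) c}

Dominated : ∀ {m} → Col → Word m → Set
Dominated p [] = ⊤
Dominated p (c ∷ r) = ColumnCovered p c (at r 0) × Dominated c r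

AllCovered : ∀ {m} → Col → Word m → Set
AllCovered p cs = ∀ i → ColumnCovered (at (p ∷ cs) (toℕ i)) (lookup cs i) (at cs (suc (toℕ i)))

dominated⇔covered : ∀ {m} p (cs : Word m) → Dominated p cs ⇔ AllCovered p cs
dominated⇔covered p cs = mk⇔ (covered p cs) (dominated p cs)
  where
  covered : ∀ {m} p (cs : Word m) → Dominated p cs → AllCovered p cs
  covered p (c ∷ r) (cov , _) zero = cov
  covered p (c ∷ r) (_ , dom) (suc i) = covered c r dom i

  dominated : ∀ {m} p (cs : Word m) → AllCovered p cs → Dominated p cs
  dominated p [] _ = tt
  dominated p (c ∷ r) cov = cov zero , dominated c r (λ i → cov (suc i))

module _ {n} (cs : Word n) where

  private
    Dominates : Vertex n → Set
    Dominates v = v ∈V unzip cs ⊎ ∃ λ u → u ∈V unzip cs × Adj u v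

    CoveredAt : Fin 2 → Fin n → Set
    CoveredAt a i = Covered a (at (O ∷ cs) (toℕ i)) (lookup cs i) (at cs (suc (toℕ i)))

  bit⇒member : ∀ a k → T (bit a (at cs k)) → Σ (Fin n) λ j → toℕ j ≡ k × (a , j) ∈V unzip cs
  bit⇒member a k t with at-inRange cs a k t
  ... | j , refl = j , refl , from (∈-unzip cs a j) (subst (λ c → T (bit a c)) (at-lookup cs j) t)

  member⇒bit : ∀ a j → (a , j) ∈V unzip cs → T (bit a (at cs (toℕ j)))
  member⇒bit a j m = subst (λ c → T (bit a c)) (sym (at-lookup cs j)) (to (∈-unzip cs a j) m)

  left⇒dominates : ∀ a i → T (bit a (at (O ∷ cs) (toℕ i))) → Dominates (a , i)
  left⇒dominates a zero left = ⊥-elim (bit-O a left)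
  left⇒dominates a (suc i) left with bit⇒member a (toℕ i) left
  ... | j , j≡i , m = inj₂ ((a , j) , m , inj₁ (refl , inj₁ (cong suc (sym j≡i))))

  covered⇒dominates : ∀ a i → CoveredAt a i → Dominates (a , i)
  covered⇒dominates a i cov with to (covered⇔ a _ _ _) cov
  ... | inj₁ left = left⇒dominates a i left
  ... | inj₂ (inj₁ self) = inj₁ (from (∈-unzip cs a i) self)
  ... | inj₂ (inj₂ (inj₁ partner)) =
    inj₂ ((other a , i) , from (∈-unzip cs (other a) i) partner , inj₂ (other-≢ a , refl))
  ... | inj₂ (inj₂ (inj₂ right)) with bit⇒member a (suc (toℕ i)) right
  ...   | j , j≡1+i , m = inj₂ ((a , j) , m , inj₁ (refl , inj₂ j≡1+i))

  dominates⇒covered : ∀ a i → Dominates (a , i) → CoveredAt a i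
  dominates⇒covered a i d = from (covered⇔ a _ _ _) (reason d)
    where
    reason : Dominates (a , i) →
      T (bit a (at (O ∷ cs) (toℕ i))) ⊎ T (bit a (lookup cs i)) ⊎
      T (bit (other a) (lookup cs i)) ⊎ T (bit a (at cs (suc (toℕ i))))
    reason (inj₁ m) = inj₂ (inj₁ (to (∈-unzip cs a i) m))
    reason (inj₂ ((_ , j) , m , inj₁ (refl , inj₁ i≡1+j))) =
      inj₁ (subst (λ k → T (bit a (at (O ∷ cs) k))) (sym i≡1+j) (member⇒bit a j m))
    reason (inj₂ ((_ , j) , m , inj₁ (refl , inj₂ j≡1+i))) =
      inj₂ (inj₂ (inj₂ (subst (λ k → T (bit a (at cs k))) j≡1+i (member⇒bit a j m))))
    reason (inj₂ ((b , _) , m , inj₂ (b≢a , refl))) =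
      inj₂ (inj₂ (inj₁ (subst (λ b → T (bit b (lookup cs i))) (≢⇒other b≢a)
                               (to (∈-unzip cs b i) m))))

  dominating⇔dominated : Dominating n (unzip cs) ⇔ Dominated O cs
  dominating⇔dominated = mk⇔
    (λ dom → from (dominated⇔covered O cs) λ i →
      dominates⇒covered zero i (dom (zero , i)) , dominates⇒covered (suc zero) i (dom (suc zero , i)))
    (λ dom (a , i) → covered⇒dominates a i (column-row (to (dominated⇔covered O cs) dom i) a))

dsize-card : ∀ {n} (cs : Word n) → dsize cs ≡ card (unzip cs) * 2
dsize-card [] = refl
dsize-card (O ∷ cs) = dsize-card cs
dsize-card (X ∷ cs) = cong (2 +_) (dsize-card cs)
dsize-card (Y ∷ cs) =
  trans (cong (2 +_) (dsize-card cs)) (cong (_* 2) (sym (+-suc ∣ xs ∣ ∣ ys ∣)))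
  where xs = proj₁ (unzip cs)
        ys = proj₂ (unzip cs)
dsize-card (B ∷ cs) =
  trans (cong (4 +_) (dsize-card cs)) (cong (λ k → suc k * 2) (sym (+-suc ∣ xs ∣ ∣ ys ∣)))
  where xs = proj₁ (unzip cs)
        ys = proj₂ (unzip cs)

data Single : Col → Set where
  only-x : Single X
  only-y : Single Y

single-swap : ∀ {c} → Single c → Single (swap c)
single-swap only-x = only-y
single-swap only-y = only-x

-- Reading a dominated word from left to right, the bound depends on the
-- column read last: after ∅ (in particular at the start) the remaining m+1
-- columns need 2 ∣D∣ ≥ m + 2, after a single vertex they need 2 ∣D∣ ≥ m,
-- and after a full column 2 ∣D∣ ≥ m - 1.
bound-start : ∀ {m} (cs : Word (suc m)) → Dominated O cs → suc (suc m) ≤ dsize cs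
bound-single : ∀ {p m} → Single p → (cs : Word m) → Dominated p cs → m ≤ dsize cs
bound-both : ∀ {m} (cs : Word m) → Dominated B cs → m ≤ suc (dsize cs)

bound-start (O ∷ []) ((() , _) , _)
bound-start (O ∷ (false , _) ∷ r) ((() , _) , _)
bound-start (O ∷ X ∷ r) ((_ , ()) , _)
bound-start (O ∷ B ∷ r) (_ , _ , dom) = s≤s (s≤s (s≤s (bound-both r dom)))
bound-start (X ∷ r) (_ , dom) = s≤s (s≤s (bound-single only-x r dom))
bound-start (Y ∷ r) (_ , dom) = s≤s (s≤s (bound-single only-y r dom))
bound-start (B ∷ r) (_ , dom) = s≤s (s≤s (m≤n⇒m≤1+n (bound-both r dom)))

bound-single s [] _ = z≤n
bound-single s (X ∷ r) (_ , dom) = s≤s (m≤n⇒m≤1+n (bound-single only-x r dom))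
bound-single s (Y ∷ r) (_ , dom) = s≤s (m≤n⇒m≤1+n (bound-single only-y r dom))
bound-single s (B ∷ r) (_ , dom) = s≤s (m≤n⇒m≤o+n 2 (bound-both r dom))
bound-single only-x (O ∷ []) ((_ , ()) , _)
bound-single only-x (O ∷ (_ , false) ∷ r) ((_ , ()) , _)
bound-single only-x (O ∷ Y ∷ r) (_ , _ , dom) = s≤s (s≤s (bound-single only-y r dom))
bound-single only-x (O ∷ B ∷ r) (_ , _ , dom) = s≤s (s≤s (m≤n⇒m≤1+n (bound-both r dom)))
bound-single only-y (O ∷ []) ((() , _) , _)
bound-single only-y (O ∷ (false , _) ∷ r) ((() , _) , _)
bound-single only-y (O ∷ X ∷ r) (_ , _ , dom) = s≤s (s≤s (bound-single only-x r dom))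
bound-single only-y (O ∷ B ∷ r) (_ , _ , dom) = s≤s (s≤s (m≤n⇒m≤1+n (bound-both r dom)))

bound-both [] _ = z≤n
bound-both (O ∷ []) _ = s≤s z≤n
bound-both (O ∷ c ∷ r) (_ , dom) = m≤n⇒m≤1+n (bound-start (c ∷ r) dom)
bound-both (X ∷ r) (_ , dom) = s≤s (m≤n⇒m≤o+n 2 (bound-single only-x r dom))
bound-both (Y ∷ r) (_ , dom) = s≤s (m≤n⇒m≤o+n 2 (bound-single only-y r dom))
bound-both (B ∷ r) (_ , dom) = s≤s (m≤n⇒m≤o+n 3 (bound-both r dom))

-- zigzag c m = c ∅ c′ ∅ c ∅ … of length m, where c′ = swap c, and
-- trail c m is what follows the column c in it.
zigzag : Col → (m : ℕ) → Word m
trail : Col → (m : ℕ) → Word m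

zigzag c zero = []
zigzag c (suc m) = c ∷ trail c m

trail c zero = []
trail c (suc m) = O ∷ zigzag (swap c) m

data Centre : ∀ {m} → Word m → Set where
  centre : Centre (O ∷ B ∷ O ∷ [])

data Gap : ∀ {m} → Word m → Set where
  gap : Gap (O ∷ [])

tight-start : ∀ {m} (cs : Word (suc m)) → Dominated O cs → dsize cs ≡ suc (suc m) →
  cs ≡ zigzag X (suc m) ⊎ cs ≡ zigzag Y (suc m) ⊎ Centre cs
tight-single : ∀ {p m} → Single p → (cs : Word m) → Dominated p cs → dsize cs ≡ m → cs ≡ trail p m
tight-both : ∀ {m} (cs : Word m) → Dominated B cs → suc (dsize cs) ≡ m → Gap cs

tight-start (O ∷ []) ((() , _) , _) _
tight-start (O ∷ (false , _) ∷ r) ((() , _) , _) _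
tight-start (O ∷ X ∷ r) ((_ , ()) , _) _
tight-start (O ∷ B ∷ r) (_ , _ , dom) eq
  with tight-both r dom (suc-injective (suc-injective (suc-injective eq)))
... | gap = inj₂ (inj₂ centre)
tight-start (X ∷ r) (_ , dom) eq =
  inj₁ (cong (X ∷_) (tight-single only-x r dom (suc-injective (suc-injective eq))))
tight-start (Y ∷ r) (_ , dom) eq =
  inj₂ (inj₁ (cong (Y ∷_) (tight-single only-y r dom (suc-injective (suc-injective eq)))))
tight-start (B ∷ r) (_ , dom) eq =
  ⊥-elim (<⇒≢ (s≤s (bound-both r dom)) (sym (suc-injective (suc-injective eq))))

tight-single s [] _ _ = refl
tight-single s (X ∷ r) (_ , dom) eq =
  ⊥-elim (<⇒≢ (s≤s (bound-single only-x r dom)) (sym (suc-injective eq)))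
tight-single s (Y ∷ r) (_ , dom) eq =
  ⊥-elim (<⇒≢ (s≤s (bound-single only-y r dom)) (sym (suc-injective eq)))
tight-single s (B ∷ r) (_ , dom) eq =
  ⊥-elim (<⇒≢ (s≤s (m≤n⇒m≤1+n (bound-both r dom))) (sym (suc-injective eq)))
tight-single only-x (O ∷ []) ((_ , ()) , _) _
tight-single only-x (O ∷ (_ , false) ∷ r) ((_ , ()) , _) _
tight-single only-x (O ∷ Y ∷ r) (_ , _ , dom) eq =
  cong (λ t → O ∷ Y ∷ t) (tight-single only-y r dom (suc-injective (suc-injective eq)))
tight-single only-x (O ∷ B ∷ r) (_ , _ , dom) eq =
  ⊥-elim (<⇒≢ (s≤s (bound-both r dom)) (sym (suc-injective (suc-injective eq))))
tight-single only-y (O ∷ []) ((() , _) , _) _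
tight-single only-y (O ∷ (false , _) ∷ r) ((() , _) , _) _
tight-single only-y (O ∷ X ∷ r) (_ , _ , dom) eq =
  cong (λ t → O ∷ X ∷ t) (tight-single only-x r dom (suc-injective (suc-injective eq)))
tight-single only-y (O ∷ B ∷ r) (_ , _ , dom) eq =
  ⊥-elim (<⇒≢ (s≤s (bound-both r dom)) (sym (suc-injective (suc-injective eq))))

tight-both [] _ ()
tight-both (O ∷ []) _ _ = gap
tight-both (O ∷ c ∷ r) (_ , dom) eq = ⊥-elim (<⇒≢ (bound-start (c ∷ r) dom) (sym (suc-injective eq)))
tight-both (X ∷ r) (_ , dom) eq =
  ⊥-elim (<⇒≢ (s≤s (m≤n⇒m≤1+n (bound-single only-x r dom))) (sym (suc-injective eq)))
tight-both (Y ∷ r) (_ , dom) eq =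
  ⊥-elim (<⇒≢ (s≤s (m≤n⇒m≤1+n (bound-single only-y r dom))) (sym (suc-injective eq)))
tight-both (B ∷ r) (_ , dom) eq =
  ⊥-elim (<⇒≢ (s≤s (m≤n⇒m≤o+n 2 (bound-both r dom))) (sym (suc-injective eq)))

trail-dominated : ∀ {c} → Single c → ∀ k → Dominated c (trail c (k * 2))
trail-dominated s zero = tt
trail-dominated only-x (suc k) = (tt , tt) , (tt , tt) , trail-dominated only-y k
trail-dominated only-y (suc k) = (tt , tt) , (tt , tt) , trail-dominated only-x k

zigzag-dominated : ∀ {c} → Single c → ∀ k → Dominated O (zigzag c (suc (k * 2)))
zigzag-dominated only-x k = (tt , tt) , trail-dominated only-x k
zigzag-dominated only-y k = (tt , tt) , trail-dominated only-y k

trail-dsize : ∀ {c} → Single c → ∀ k → dsize (trail c (k * 2)) ≡ k * 2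
trail-dsize s zero = refl
trail-dsize only-x (suc k) = cong (2 +_) (trail-dsize only-y k)
trail-dsize only-y (suc k) = cong (2 +_) (trail-dsize only-x k)

zigzag-dsize : ∀ {c} → Single c → ∀ k → dsize (zigzag c (suc (k * 2))) ≡ suc (suc (k * 2))
zigzag-dsize only-x k = cong (2 +_) (trail-dsize only-x k)
zigzag-dsize only-y k = cong (2 +_) (trail-dsize only-y k)

zigzag-swap : ∀ c m → zigzag (swap c) m ≡ map swap (zigzag c m)
trail-swap : ∀ c m → trail (swap c) m ≡ map swap (trail c m)

zigzag-swap c zero = refl
zigzag-swap c (suc m) = cong (swap c ∷_) (trail-swap c m)

trail-swap c zero = refl
trail-swap c (suc m) = cong (O ∷_) (zigzag-swap (swap c) m)

zigzag-weight : ∀ {c} → Single c → ∀ m (i : Fin m) →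
  weight (lookup (zigzag c m) i) ≡ suc (toℕ i) % 2
zigzag-weight only-x (suc m) zero = refl
zigzag-weight only-y (suc m) zero = refl
zigzag-weight s (suc (suc m)) (suc zero) = refl
zigzag-weight s (suc (suc m)) (suc (suc i)) = zigzag-weight (single-swap s) m i

domination-bound : ∀ {m} (D : VSet₂ (suc m)) → Dominating (suc m) D → suc (suc m) ≤ card D * 2
domination-bound D dom with columns D
... | cs , refl =
  subst (_ ≤_) (dsize-card cs) (bound-start cs (to (dominating⇔dominated cs) dom))

tight⇒minimum : ∀ {m} (cs : Word (suc m)) → Dominated O cs → dsize cs ≡ suc (suc m) →
  MinDominating (suc m) (unzip cs)
tight⇒minimum {m} cs dom tight = from (dominating⇔dominated cs) dom , least
  where
  open ≤-Reasoning
  least : ∀ D′ → Dominating (suc m) D′ → card (unzip cs) ≤ card D′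
  least D′ dom′ = *-cancelʳ-≤ (card (unzip cs)) (card D′) 2 (begin
    card (unzip cs) * 2 ≡⟨ sym (dsize-card cs) ⟩
    dsize cs            ≡⟨ tight ⟩
    suc (suc m)         ≤⟨ domination-bound D′ dom′ ⟩
    card D′ * 2         ∎)

minimum⇒tight : ∀ {m} (ws : Word (suc m)) → Dominated O ws → dsize ws ≡ suc (suc m) →
  ∀ cs → MinDominating (suc m) (unzip cs) → dsize cs ≡ suc (suc m)
minimum⇒tight {m} ws domʷ tight cs (dom , least) =
  ≤-antisym upper (bound-start cs (to (dominating⇔dominated cs) dom))
  where
  open ≤-Reasoning
  upper : dsize cs ≤ suc (suc m)
  upper = begin
    dsize cs            ≡⟨ dsize-card cs ⟩
    card (unzip cs) * 2 ≤⟨ *-monoˡ-≤ 2 (least (unzip ws) (from (dominating⇔dominated ws) domʷ)) ⟩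
    card (unzip ws) * 2 ≡⟨ sym (dsize-card ws) ⟩
    dsize ws            ≡⟨ tight ⟩
    suc (suc m)         ∎

zigzagSet : Col → ∀ k → VSet₂ (suc (k * 2))
zigzagSet c k = unzip (zigzag c (suc (k * 2)))

exceptional : ∀ k → List (VSet₂ (suc (k * 2)))
exceptional 1 = unzip (O ∷ B ∷ O ∷ []) ∷ []
exceptional _ = []

minimumSets : ∀ k → List (VSet₂ (suc (k * 2)))
minimumSets k = zigzagSet X k ∷ zigzagSet Y k ∷ exceptional k

-- The listed sets are pairwise distinct (they differ in an early column).
minimumSets-unique : ∀ k → Unique (minimumSets k)
minimumSets-unique 0 = ((λ ()) ∷ []) ∷ [] ∷ []
minimumSets-unique 1 = ((λ ()) ∷ (λ ()) ∷ []) ∷ ((λ ()) ∷ []) ∷ [] ∷ []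
minimumSets-unique (suc (suc k)) = ((λ ()) ∷ []) ∷ [] ∷ []

zigzag-minimum : ∀ {c} → Single c → ∀ k → MinDominating (suc (k * 2)) (zigzagSet c k)
zigzag-minimum s k = tight⇒minimum _ (zigzag-dominated s k) (zigzag-dsize s k)

minimumSets-complete : ∀ k D → D ∈ₗ minimumSets k ⇔ MinDominating (suc (k * 2)) D
minimumSets-complete k D = mk⇔ (listed⇒minimum k D) (minimum⇒listed D)
  where
  listed⇒minimum : ∀ k D → D ∈ₗ minimumSets k → MinDominating (suc (k * 2)) D
  listed⇒minimum k _ (here refl) = zigzag-minimum only-x k
  listed⇒minimum k _ (there (here refl)) = zigzag-minimum only-y k
  listed⇒minimum 1 _ (there (there (here refl))) =
    tight⇒minimum (O ∷ B ∷ O ∷ []) ((tt , tt) , (tt , tt) , (tt , tt) , tt) refl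

  centre-listed : ∀ k (cs : Word (suc (k * 2))) → Centre cs → unzip cs ∈ₗ exceptional k
  centre-listed 1 _ centre = here refl

  minimum⇒listed : ∀ D → MinDominating (suc (k * 2)) D → D ∈ₗ minimumSets k
  minimum⇒listed D min with columns D
  ... | cs , refl
      with tight-start cs (to (dominating⇔dominated cs) (proj₁ min))
             (minimum⇒tight _ (zigzag-dominated only-x k) (zigzag-dsize only-x k) cs min)
  ... | inj₁ refl = here refl
  ... | inj₂ (inj₁ refl) = there (here refl)
  ... | inj₂ (inj₂ c) = there (there (centre-listed k cs c))

DV-count : ∀ {n} (Ms : List (VSet₂ n)) → Unique Ms → (∀ D → D ∈ₗ Ms ⇔ MinDominating n D) →
  ∀ v → DV n v (length (filter (v ∈V?_) Ms))
DV-count Ms unique complete v =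
  filter (v ∈V?_) Ms , filter⁺ (v ∈V?_) unique , refl , λ D → mk⇔
    (λ D∈ → let D∈Ms , v∈D = ∈-filter⁻ (v ∈V?_) D∈ in to (complete D) D∈Ms , v∈D)
    (λ (min , v∈D) → ∈-filter⁺ (v ∈V?_) (from (complete D) min) v∈D)

length-filter-∷ : ∀ {A : Set} {P : A → Set} (P? : ∀ x → Dec (P x)) x xs →
  length (filter P? (x ∷ xs)) ≡ indicator (does (P? x)) + length (filter P? xs)
length-filter-∷ P? x xs with does (P? x)
... | true = refl
... | false = refl

indicator-mirror : ∀ a c → indicator (bit a c) + indicator (bit a (swap c)) ≡ weight c
indicator-mirror zero (b₁ , b₂) = refl
indicator-mirror (suc zero) (b₁ , b₂) = +-comm (indicator b₂) (indicator b₁)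

count-mirror : ∀ {n} (cs ds : Word n) → ds ≡ map swap cs → ∀ a i →
  length (filter ((a , i) ∈V?_) (unzip cs ∷ unzip ds ∷ [])) ≡ weight (lookup cs i)
count-mirror cs _ refl a i = begin
  length (filter v∈? (unzip cs ∷ unzip (map swap cs) ∷ []))
    ≡⟨ length-filter-∷ v∈? (unzip cs) _ ⟩
  indicator (does (v∈? (unzip cs))) + length (filter v∈? (unzip (map swap cs) ∷ []))
    ≡⟨ cong (indicator (does (v∈? (unzip cs))) +_) (length-filter-∷ v∈? _ []) ⟩
  indicator (does (v∈? (unzip cs))) + (indicator (does (v∈? (unzip (map swap cs)))) + 0)
    ≡⟨ cong₂ (λ b b′ → indicator b + b′) (does-∈V? cs a i)
         (trans (+-identityʳ _) (cong indicator (does-∈V? (map swap cs) a i))) ⟩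
  indicator (bit a (lookup cs i)) + indicator (bit a (lookup (map swap cs) i))
    ≡⟨ cong (λ c → indicator (bit a (lookup cs i)) + indicator (bit a c)) (lookup-map i swap cs) ⟩
  indicator (bit a (lookup cs i)) + indicator (bit a (swap (lookup cs i)))
    ≡⟨ indicator-mirror a (lookup cs i) ⟩
  weight (lookup cs i) ∎
  where
  open ≡-Reasoning
  v∈? = (a , i) ∈V?_

-- For n = 2k + 5 the domination value of x_{i+1} and y_{i+1} is (i + 1) mod 2:
-- only the two zigzags are minimum, and column i of the first holds
-- (i + 1) mod 2 vertices.
DV-large : ∀ k a (i : Fin (suc (suc (suc k) * 2))) →
  DV (suc (suc (suc k) * 2)) (a , i) (suc (toℕ i) % 2)
DV-large k a i = subst (DV n (a , i)) count
  (DV-count (minimumSets (2 + k)) (minimumSets-unique (2 + k)) (minimumSets-complete (2 + k)) (a , i))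
  where
  n = suc (suc (suc k) * 2)
  count : length (filter ((a , i) ∈V?_) (minimumSets (2 + k))) ≡ suc (toℕ i) % 2
  count = trans (count-mirror (zigzag X n) (zigzag Y n) (zigzag-swap X n) a i) (zigzag-weight only-x n i)

DV-three : ∀ v → DV 3 v 1
DV-three v =
  subst (DV 3 v) (count v) (DV-count (minimumSets 1) (minimumSets-unique 1) (minimumSets-complete 1) v)
  where
  count : ∀ v → length (filter (v ∈V?_) (minimumSets 1)) ≡ 1
  count (zero , zero) = refl
  count (zero , suc zero) = refl
  count (zero , suc (suc zero)) = refl
  count (suc zero , zero) = refl
  count (suc zero , suc zero) = refl
  count (suc zero , suc (suc zero)) = refl

odd-form : ∀ n → n % 2 ≡ 1 → Σ ℕ λ k → n ≡ suc (k * 2)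
odd-form n odd = n / 2 , trans (m≡m%n+[m/n]*n n 2) (cong (_+ n / 2 * 2) odd)

corollary3p5 : (n : ℕ) → 3 ≤ n → n % 2 ≡ 1 →
    ((n ≡ 3 → (v : Vertex n) → DV n v 1)
    × (5 ≤ n → (a : Fin 2) (i : Fin n) →
         (suc (toℕ i) % 2 ≡ 1 → DV n (a , i) 1)
         × (suc (toℕ i) % 2 ≡ 0 → DV n (a , i) 0)))
corollary3p5 n 3≤n odd with odd-form n odd
... | 1 , refl = (λ _ → DV-three) , λ { (s≤s (s≤s (s≤s ()))) }
... | suc (suc k) , refl = (λ ()) , λ _ a i →
  (λ odd-position → subst (DV _ (a , i)) odd-position (DV-large k a i)) ,
  (λ even-position → subst (DV _ (a , i)) even-position (DV-large k a i))
... | zero , refl with 3≤n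
...   | s≤s ()
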